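{- Let $(\mathcal V,(\delta_n)_{n\ge1})$ be a locally finite brace coalgebra with associated coassociative coproduct $\Delta$ on $\mathcal T\langle\mathcal V\rangle$. Then $(\mathcal V,\delta_1)$ is a preLie coalgebra, i.e. $(\delta_1\otimes\mathrm{Id}-\mathrm{Id}\otimes\delta_1)\circ\delta_1=(\mathrm{Id}\otimes\tau)\circ(\delta_1\otimes\mathrm{Id}-\mathrm{Id}\otimes\delta_1)\circ\delta_1$, where $\tau(u\otimes v)=v\otimes u$.
   Context: $\mathcal V$ is a vector space over a field and $\mathcal T\langle\mathcal V\rangle$ its tensor algebra with concatenation product and unit $1$. A locally finite brace coalgebra is a family of linear maps $\delta_n:\mathcal V\to\mathcal V\otimes\mathcal V^{\otimes n}$, $n\ge1$, such that for every $v\in\mathcal V$ there is $N(v)$ with $\delta_n(v)=0$ for $n\ge N(v)$, and such that the algebra morphism $\Delta:\mathcal T\langle\mathcal V\rangle\to\mathcal T\langle\mathcal V\rangle\otimes\mathcal T\langle\mathcal V\rangle$ determined by $\Delta(v)=1\otimes v+v\otimes1+\sum_{n\ge1}\delta_n(v)$ for $v\in\mathcal V$ (with $\mathcal V\otimes\mathcal V^{\otimes n}\subseteq\mathcal T\langle\mathcal V\rangle\otimes\mathcal T\langle\mathcal V\rangle$) is coassociative. -}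

module Defs where

open import Level using (Level; _⊔_) renaming (suc to lsuc; zero to lzero)
open import Algebra.Bundles using (CommutativeRing)
open import Algebra.Module.Bundles using (Module)
open import Data.Nat using (ℕ; zero; suc; _≤_; _∸_)
open import Data.Fin using (Fin)
open import Data.Product using (Σ; ∃; _×_; _,_; proj₁)
open import Data.List using (List; []; _∷_; _++_; map; concatMap; foldr; upTo; length; _[_]∷=_)
open import Data.Vec as Vec using (Vec; lookup; _[_]≔_; zipWith; replicate; toList)
import Data.Vec.Relation.Binary.Pointwise.Inductive as VecPW
import Data.List.Relation.Binary.Pointwise as ListPW
open import Relation.Nullary using (¬_)

record Field (c ℓ : Level) : Set (lsuc (c ⊔ ℓ)) where
  field
    commutativeRing : CommutativeRing c ℓ
  open CommutativeRing commutativeRing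
  field
    nontrivial : ¬ (1# ≈ 0#)
    inverse    : ∀ x → ¬ (x ≈ 0#) → ∃ λ y → (x * y) ≈ 1#

module Tensors {c ℓ m ℓm : Level} (K : Field c ℓ)
               (V : Module (Field.commutativeRing K) m ℓm) where

  open CommutativeRing (Field.commutativeRing K)
  open Module V using (Carrierᴹ; _≈ᴹ_; _+ᴹ_; _*ₗ_)

  FS : ∀ {g} → Set g → Set (c ⊔ g)
  FS G = List (Carrier × G)

  scale : ∀ {g} {G : Set g} → Carrier → FS G → FS G
  scale a = map (λ { (b , w) → (a * b , w) })

  neg : ∀ {g} {G : Set g} → FS G → FS G
  neg = scale (- 1#)

  bind : ∀ {g h} {G : Set g} {H : Set h} → (G → FS H) → FS G → FS H
  bind f = concatMap (λ { (a , w) → scale a (f w) })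

  -- The tensor-product quotient: the free K-module on generators G
  -- (words whose letters, the "slots", are vectors of V) modulo
  -- multilinearity in every slot.  x ∼ y means x and y represent the
  -- same tensor.
  module Quotient {g e} (G : Set g) (_≋_ : G → G → Set e)
                  (Slot : G → Set) (put : (w : G) → Slot w → Carrierᴹ → G) where
    infix 4 _∼_
    data _∼_ : FS G → FS G → Set (c ⊔ ℓ ⊔ m ⊔ g ⊔ e) where
      ∼-refl  : ∀ {x} → x ∼ x
      ∼-sym   : ∀ {x y} → x ∼ y → y ∼ x
      ∼-trans : ∀ {x y z} → x ∼ y → y ∼ z → x ∼ z
      ∼-++    : ∀ {x x′ y y′} → x ∼ x′ → y ∼ y′ → (x ++ y) ∼ (x′ ++ y′)
      ∼-comm  : ∀ x y → (x ++ y) ∼ (y ++ x)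
      ∼-zero  : ∀ w → ((0# , w) ∷ []) ∼ []
      ∼-merge : ∀ a b w → ((a , w) ∷ (b , w) ∷ []) ∼ ((a + b , w) ∷ [])
      ∼-coef  : ∀ {a b} w → a ≈ b → ((a , w) ∷ []) ∼ ((b , w) ∷ [])
      ∼-gen   : ∀ a {w w′} → w ≋ w′ → ((a , w) ∷ []) ∼ ((a , w′) ∷ [])
      ∼-add   : ∀ a w s x y →
                ((a , put w s (x +ᴹ y)) ∷ []) ∼ ((a , put w s x) ∷ (a , put w s y) ∷ [])
      ∼-hom   : ∀ a w s b x →
                ((a , put w s (b *ₗ x)) ∷ []) ∼ ((a * b , put w s x) ∷ [])

  Word : ℕ → Set m
  Word k = Vec Carrierᴹ k

  module PowQ (k : ℕ) = Quotient (Word k) (VecPW.Pointwise _≈ᴹ_) (λ _ → Fin k) _[_]≔_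

  infix 4 _≈⊗_ _≈T_
  _≈⊗_ : ∀ {k} → FS (Word k) → FS (Word k) → Set _
  _≈⊗_ {k} x y = PowQ._∼_ k x y

  -- T⟨V⟩^{⊗r}: generated by w₁ ⊗ ⋯ ⊗ w_r with each wᵢ a word (list) in V,
  -- i.e. T⟨V⟩ = ⊕ₙ V^{⊗n} with the word w = v₁⋯vₙ standing for v₁⊗⋯⊗vₙ.

  MWord : ℕ → Set m
  MWord r = Vec (List Carrierᴹ) r

  MSlot : ∀ {r} → MWord r → Set
  MSlot {r} w = Σ (Fin r) λ i → Fin (length (lookup w i))

  mput : ∀ {r} (w : MWord r) → MSlot w → Carrierᴹ → MWord r
  mput w (i , j) x = w [ i ]≔ (lookup w i [ j ]∷= x)

  module TQ (r : ℕ) = Quotient (MWord r) (VecPW.Pointwise (ListPW.Pointwise _≈ᴹ_)) MSlot mput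

  _≈T_ : ∀ {r} → FS (MWord r) → FS (MWord r) → Set _
  _≈T_ {r} x y = TQ._∼_ r x y

  unitT : ∀ {r} → FS (MWord r)
  unitT {r} = (1# , replicate r []) ∷ []

  mulT : ∀ {r} → FS (MWord r) → FS (MWord r) → FS (MWord r)
  mulT x y = concatMap (λ { (a , u) → map (λ { (b , v) → (a * b , zipWith _++_ u v) }) y }) x

  prodT : ∀ {r} → List (FS (MWord r)) → FS (MWord r)
  prodT = foldr mulT unitT

  -- Brace coalgebra data.  δ k stands for δ_{k+1} : V → V ⊗ V^{⊗(k+1)},
  -- so the paper's family (δ_n)_{n ≥ 1} is (δ k)_{k ≥ 0}.

  record BraceData : Set (lsuc (c ⊔ ℓ ⊔ m ⊔ ℓm)) where
    field
      δ       : (k : ℕ) → Carrierᴹ → FS (Word (suc (suc k)))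
      δ-cong  : ∀ k {x y} → x ≈ᴹ y → δ k x ≈⊗ δ k y
      δ-+     : ∀ k x y → δ k (x +ᴹ y) ≈⊗ (δ k x ++ δ k y)
      δ-*     : ∀ k a x → δ k (a *ₗ x) ≈⊗ scale a (δ k x)
      locallyFinite : ∀ v → ∃ λ N → ∀ k → N ≤ suc k → δ k v ≈⊗ []

    N : Carrierᴹ → ℕ
    N v = proj₁ (locallyFinite v)

    embed : ∀ {k} → Word (suc k) → MWord 2
    embed (a Vec.∷ bs) = (a ∷ []) Vec.∷ toList bs Vec.∷ Vec.[]

    -- Δ(v) = 1 ⊗ v + v ⊗ 1 + Σ_{1 ≤ n < N(v)} δ_n(v)
    Δv : Carrierᴹ → FS (MWord 2)
    Δv v = (1# , [] Vec.∷ (v ∷ []) Vec.∷ Vec.[])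
         ∷ (1# , (v ∷ []) Vec.∷ [] Vec.∷ Vec.[])
         ∷ concatMap (λ k → bind (λ w → (1# , embed w) ∷ []) (δ k v)) (upTo (N v ∸ 1))

    Δword : List Carrierᴹ → FS (MWord 2)
    Δword w = prodT (map Δv w)

    Δ : FS (MWord 1) → FS (MWord 2)
    Δ = bind (λ { (w Vec.∷ Vec.[]) → Δword w })

    Δ⊗id : FS (MWord 2) → FS (MWord 3)
    Δ⊗id = bind (λ { (u Vec.∷ w Vec.∷ Vec.[]) →
             bind (λ { (a Vec.∷ b Vec.∷ Vec.[]) → (1# , a Vec.∷ b Vec.∷ w Vec.∷ Vec.[]) ∷ [] })
                  (Δword u) })

    id⊗Δ : FS (MWord 2) → FS (MWord 3)
    id⊗Δ = bind (λ { (u Vec.∷ w Vec.∷ Vec.[]) →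
             bind (λ { (a Vec.∷ b Vec.∷ Vec.[]) → (1# , u Vec.∷ a Vec.∷ b Vec.∷ Vec.[]) ∷ [] })
                  (Δword w) })

    Coassociative : Set (c ⊔ ℓ ⊔ m ⊔ ℓm)
    Coassociative = ∀ x → Δ⊗id (Δ x) ≈T id⊗Δ (Δ x)

  record LocallyFiniteBraceCoalgebra : Set (lsuc (c ⊔ ℓ ⊔ m ⊔ ℓm)) where
    field
      braceData : BraceData
    open BraceData braceData public
    field
      coassociative : Coassociative

  module _ (δ₁ : Carrierᴹ → FS (Word 2)) where
    δ₁⊗Id : Word 2 → FS (Word 3)
    δ₁⊗Id (a Vec.∷ b Vec.∷ Vec.[]) =
      bind (λ { (x Vec.∷ y Vec.∷ Vec.[]) → (1# , x Vec.∷ y Vec.∷ b Vec.∷ Vec.[]) ∷ [] }) (δ₁ a)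

    Id⊗δ₁ : Word 2 → FS (Word 3)
    Id⊗δ₁ (a Vec.∷ b Vec.∷ Vec.[]) =
      bind (λ { (x Vec.∷ y Vec.∷ Vec.[]) → (1# , a Vec.∷ x Vec.∷ y Vec.∷ Vec.[]) ∷ [] }) (δ₁ b)

    Id⊗τ : Word 3 → Word 3
    Id⊗τ (a Vec.∷ b Vec.∷ d Vec.∷ Vec.[]) = a Vec.∷ d Vec.∷ b Vec.∷ Vec.[]

    assocδ₁ : Carrierᴹ → FS (Word 3)
    assocδ₁ v = bind (λ w → δ₁⊗Id w ++ neg (Id⊗δ₁ w)) (δ₁ v)

    IsPreLieCoalgebra : Set (c ⊔ ℓ ⊔ m ⊔ ℓm)
    IsPreLieCoalgebra =
      ∀ v → assocδ₁ v ≈⊗ bind (λ w → (1# , Id⊗τ w) ∷ []) (assocδ₁ v)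

-- Apply coassociativity of Δ to a generator v and project T⟨V⟩^{⊗3} onto V ⊗ V ⊗ V, the part in which
-- every tensor factor has degree one.  Since δₙ lands in V ⊗ V^{⊗n}, only δ₁ survives on the side
-- (Δ ⊗ Id) Δ v, giving (δ₁ ⊗ Id) δ₁ v; on the side (Id ⊗ Δ) Δ v we get (Id ⊗ δ₁) δ₁ v from δ₁ and,
-- from δ₂ v = Σ a ⊗ b₁ b₂, the degree-(1,1) part b₁ ⊗ b₂ + b₂ ⊗ b₁ of Δ(b₁ b₂).  Hence
-- (δ₁ ⊗ Id − Id ⊗ δ₁) δ₁ = (Id ⊗ (1 + τ)) δ₂, which is invariant under Id ⊗ τ.
module Submission where

open import Defs
open import Level using (Level; _⊔_)
open import Algebra.Bundles using (CommutativeRing)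
open import Algebra.Module.Bundles using (Module)
open import Data.Nat as ℕ using (ℕ; zero; suc; z≤n; s≤s; _∸_; _≤_; _≤′_; ≤′-refl; ≤′-step)
open import Data.Nat.Properties
  using (≤-trans; ≤-total; ≤⇒≤′; ≤′⇒≤; +-mono-≤; m≤n+m∸n; +-commutativeSemigroup)
open import Algebra.Properties.CommutativeSemigroup +-commutativeSemigroup
  using () renaming (interchange to +-interchange)
open import Data.Fin using (Fin; zero; suc)
open import Data.Product using (_,_; proj₂)
open import Data.Sum using (inj₁; inj₂)
open import Data.List using (List; []; _∷_; _++_; map; concatMap; upTo; length; [_])
open import Data.List.Properties using (++-assoc; ++-identityʳ; map-++; concatMap-++; upTo-∷ʳ; length-++)
open import Data.Vec as Vec using (_∷_; []; zipWith; replicate)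
open import Data.Maybe as Maybe using (Maybe; just; nothing; maybe′)
open import Data.Maybe.Properties using (map-∘)
open import Data.Maybe.Relation.Binary.Pointwise as MaybePW using (just; nothing)
open import Data.Vec.Relation.Binary.Pointwise.Inductive as VecPW using ([]; _∷_)
open import Data.List.Relation.Binary.Pointwise as ListPW using ([]; _∷_)
open import Relation.Binary.Bundles using (Setoid)
open import Relation.Binary.PropositionalEquality using (_≡_; refl; sym; trans; cong; cong₂; subst)
import Relation.Binary.Reasoning.Setoid as SetoidReasoning

module Proof {c ℓ m ℓm : Level} (K : Field c ℓ)
             (V : Module (Field.commutativeRing K) m ℓm) where
  open Tensors K V
  open CommutativeRing (Field.commutativeRing K)
    using (_≈_; _+_; _*_; -_; 0#; 1#; *-assoc; *-comm; *-identityˡ; *-identityʳ;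
           zeroˡ; zeroʳ; distribˡ; distribʳ; -‿inverseʳ; *-congˡ; *-congʳ)
    renaming (sym to ≈-sym)
  open Module V using (Carrierᴹ; _≈ᴹ_; _+ᴹ_; _*ₗ_; ≈ᴹ-refl)

  relabel : ∀ {g h} {G : Set g} {H : Set h} → (G → H) → G → FS H
  relabel φ w = (1# , φ w) ∷ []

  module FormalSums {g e} (G : Set g) (_≋_ : G → G → Set e) (Slot : G → Set)
                    (put : (w : G) → Slot w → Carrierᴹ → G) where
    open Quotient G _≋_ Slot put public

    ∼-setoid : Setoid (c ⊔ g) (c ⊔ ℓ ⊔ m ⊔ g ⊔ e)
    ∼-setoid = record
      { Carrier = FS G ; _≈_ = _∼_
      ; isEquivalence = record { refl = ∼-refl ; sym = ∼-sym ; trans = ∼-trans } }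

    ≡⇒∼ : ∀ {x y} → x ≡ y → x ∼ y
    ≡⇒∼ refl = ∼-refl

    infixr 5 _⟨∼⟩_
    _⟨∼⟩_ : ∀ {x y z} → x ∼ y → y ∼ z → x ∼ z
    _⟨∼⟩_ = ∼-trans

    ++-congˡ : ∀ x {y y′} → y ∼ y′ → (x ++ y) ∼ (x ++ y′)
    ++-congˡ x = ∼-++ ∼-refl

    ++-congʳ : ∀ y {x x′} → x ∼ x′ → (x ++ y) ∼ (x′ ++ y)
    ++-congʳ y p = ∼-++ p ∼-refl

    ++-interchange : ∀ x y z w → ((x ++ y) ++ (z ++ w)) ∼ ((x ++ z) ++ (y ++ w))
    ++-interchange x y z w =
      ≡⇒∼ (++-assoc x y (z ++ w)) ⟨∼⟩
      ++-congˡ x (≡⇒∼ (sym (++-assoc y z w)) ⟨∼⟩ ++-congʳ w (∼-comm y z) ⟨∼⟩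
                  ≡⇒∼ (++-assoc z y w)) ⟨∼⟩
      ≡⇒∼ (sym (++-assoc x z (y ++ w)))

    ∼-hom-1# : ∀ w s b x → ((1# , put w s (b *ₗ x)) ∷ []) ∼ scale b ((1# , put w s x) ∷ [])
    ∼-hom-1# w s b x = ∼-hom 1# w s b x ⟨∼⟩ ∼-coef _ (*-comm 1# b)

    scale-congˡ : ∀ {a b} → a ≈ b → ∀ x → scale a x ∼ scale b x
    scale-congˡ p [] = ∼-refl
    scale-congˡ p ((_ , w) ∷ x) = ∼-++ (∼-coef w (*-congʳ p)) (scale-congˡ p x)

    scale-assoc : ∀ a b x → scale a (scale b x) ∼ scale (a * b) x
    scale-assoc a b [] = ∼-refl
    scale-assoc a b ((d , w) ∷ x) = ∼-++ (∼-coef w (≈-sym (*-assoc a b d))) (scale-assoc a b x)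

    scale-identity : ∀ x → scale 1# x ∼ x
    scale-identity [] = ∼-refl
    scale-identity ((d , w) ∷ x) = ∼-++ (∼-coef w (*-identityˡ d)) (scale-identity x)

    scale-zero : ∀ x → scale 0# x ∼ []
    scale-zero [] = ∼-refl
    scale-zero ((d , w) ∷ x) = ∼-++ (∼-coef w (zeroˡ d) ⟨∼⟩ ∼-zero w) (scale-zero x)

    scale-congʳ : ∀ a {x y} → x ∼ y → scale a x ∼ scale a y
    scale-congʳ a ∼-refl = ∼-refl
    scale-congʳ a (∼-sym p) = ∼-sym (scale-congʳ a p)
    scale-congʳ a (∼-trans p q) = scale-congʳ a p ⟨∼⟩ scale-congʳ a q
    scale-congʳ a (∼-++ {x} {x′} {y} {y′} p q) =
      ≡⇒∼ (map-++ _ x y) ⟨∼⟩ ∼-++ (scale-congʳ a p) (scale-congʳ a q) ⟨∼⟩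
      ≡⇒∼ (sym (map-++ _ x′ y′))
    scale-congʳ a (∼-comm x y) =
      ≡⇒∼ (map-++ _ x y) ⟨∼⟩ ∼-comm (scale a x) (scale a y) ⟨∼⟩ ≡⇒∼ (sym (map-++ _ y x))
    scale-congʳ a (∼-zero w) = ∼-coef w (zeroʳ a) ⟨∼⟩ ∼-zero w
    scale-congʳ a (∼-merge b d w) = ∼-merge _ _ w ⟨∼⟩ ∼-coef w (≈-sym (distribˡ a b d))
    scale-congʳ a (∼-coef w p) = ∼-coef w (*-congˡ p)
    scale-congʳ a (∼-gen b p) = ∼-gen _ p
    scale-congʳ a (∼-add b w s x y) = ∼-add _ w s x y
    scale-congʳ a (∼-hom b w s d x) = ∼-hom _ w s d x ⟨∼⟩ ∼-coef _ (*-assoc a b d)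

    scale-distribʳ : ∀ a b x → (scale a x ++ scale b x) ∼ scale (a + b) x
    scale-distribʳ a b [] = ∼-refl
    scale-distribʳ a b ((d , w) ∷ x) =
      ∼-++ {x = (a * d , w) ∷ []} ∼-refl
           (≡⇒∼ (sym (++-assoc (scale a x) _ (scale b x))) ⟨∼⟩
            ++-congʳ (scale b x) (∼-comm (scale a x) _)) ⟨∼⟩
      ∼-++ {x = (a * d , w) ∷ (b * d , w) ∷ []}
           (∼-merge _ _ w ⟨∼⟩ ∼-coef w (≈-sym (distribʳ d a b))) (scale-distribʳ a b x)

    neg-inverseʳ : ∀ x → (x ++ neg x) ∼ []
    neg-inverseʳ x =
      ++-congʳ (neg x) (∼-sym (scale-identity x)) ⟨∼⟩ scale-distribʳ 1# (- 1#) x ⟨∼⟩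
      scale-congˡ (-‿inverseʳ 1#) x ⟨∼⟩ scale-zero x

    module _ {s} {S : Set s} where
      bind-++ : (f : S → FS G) → ∀ x y → bind f (x ++ y) ≡ bind f x ++ bind f y
      bind-++ f = concatMap-++ _

      bind-scale : (f : S → FS G) → ∀ a x → bind f (scale a x) ∼ scale a (bind f x)
      bind-scale f a [] = ∼-refl
      bind-scale f a ((b , w) ∷ x) =
        ∼-++ (∼-sym (scale-assoc a b (f w))) (bind-scale f a x) ⟨∼⟩
        ≡⇒∼ (sym (map-++ _ (scale b (f w)) (bind f x)))

      bind-scaleᶠ : (f : S → FS G) → ∀ a x → bind (λ w → scale a (f w)) x ∼ scale a (bind f x)
      bind-scaleᶠ f a [] = ∼-refl
      bind-scaleᶠ f a ((b , w) ∷ x) =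
        ∼-++ (scale-assoc b a (f w) ⟨∼⟩ scale-congˡ (*-comm b a) (f w) ⟨∼⟩ ∼-sym (scale-assoc a b (f w)))
             (bind-scaleᶠ f a x) ⟨∼⟩
        ≡⇒∼ (sym (map-++ _ (scale b (f w)) (bind f x)))

      bind-congˡ : {f h : S → FS G} → (∀ w → f w ∼ h w) → ∀ x → bind f x ∼ bind h x
      bind-congˡ p [] = ∼-refl
      bind-congˡ p ((a , w) ∷ x) = ∼-++ (scale-congʳ a (p w)) (bind-congˡ p x)

      bind-≗ : {f h : S → FS G} → (∀ w → f w ≡ h w) → ∀ x → bind f x ≡ bind h x
      bind-≗ p [] = refl
      bind-≗ p ((a , w) ∷ x) = cong₂ (λ u v → scale a u ++ v) (p w) (bind-≗ p x)

      bind-vanish : {f : S → FS G} → (∀ w → f w ∼ []) → ∀ x → bind f x ∼ []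
      bind-vanish p [] = ∼-refl
      bind-vanish p ((a , w) ∷ x) = ∼-++ (scale-congʳ a (p w)) (bind-vanish p x)

      bind-++ᶠ : (f h : S → FS G) → ∀ x → bind (λ w → f w ++ h w) x ∼ (bind f x ++ bind h x)
      bind-++ᶠ f h [] = ∼-refl
      bind-++ᶠ f h ((a , w) ∷ x) =
        ∼-++ (≡⇒∼ (map-++ _ (f w) (h w))) (bind-++ᶠ f h x) ⟨∼⟩
        ++-interchange (scale a (f w)) (scale a (h w)) (bind f x) (bind h x)

      bind-return : (f : S → FS G) → ∀ w → bind f ((1# , w) ∷ []) ∼ f w
      bind-return f w = ≡⇒∼ (++-identityʳ _) ⟨∼⟩ scale-identity (f w)

      bind-concatMap : ∀ {t} {T : Set t} (f : S → FS G) (H : T → FS S) ks →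
                       bind f (concatMap H ks) ≡ concatMap (λ k → bind f (H k)) ks
      bind-concatMap f H [] = refl
      bind-concatMap f H (k ∷ ks) =
        trans (bind-++ f (H k) (concatMap H ks)) (cong (bind f (H k) ++_) (bind-concatMap f H ks))

      bind-bind : ∀ {t} {T : Set t} (f : T → FS S) (h : S → FS G) →
                  ∀ x → bind h (bind f x) ∼ bind (λ w → bind h (f w)) x
      bind-bind f h [] = ∼-refl
      bind-bind f h ((a , w) ∷ x) =
        ≡⇒∼ (bind-++ h (scale a (f w)) (bind f x)) ⟨∼⟩ ∼-++ (bind-scale h a (f w)) (bind-bind f h x)

    bind-relabel-id : ∀ x → bind (relabel (λ w → w)) x ∼ x
    bind-relabel-id [] = ∼-refl
    bind-relabel-id ((a , w) ∷ x) = ∼-++ (∼-coef w (*-identityʳ a)) (bind-relabel-id x)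

    concatMap-cong : ∀ {t} {T : Set t} {H H′ : T → FS G} → (∀ k → H k ∼ H′ k) →
                     ∀ ks → concatMap H ks ∼ concatMap H′ ks
    concatMap-cong p [] = ∼-refl
    concatMap-cong p (k ∷ ks) = ∼-++ (p k) (concatMap-cong p ks)

    concatMap-vanish : ∀ {t} {T : Set t} {H : T → FS G} → (∀ k → H k ∼ []) → ∀ ks → concatMap H ks ∼ []
    concatMap-vanish p [] = ∼-refl
    concatMap-vanish p (k ∷ ks) = ∼-++ (p k) (concatMap-vanish p ks)

    concatMap-upTo-extend : ∀ (H : ℕ → FS G) {n m} → (∀ k → n ≤ k → H k ∼ []) → n ≤′ m →
                            concatMap H (upTo m) ∼ concatMap H (upTo n)
    concatMap-upTo-extend H tail ≤′-refl = ∼-refl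
    concatMap-upTo-extend H {n} tail (≤′-step {m} n≤′m) =
      ≡⇒∼ (trans (cong (concatMap H) (sym (upTo-∷ʳ m))) (concatMap-++ H (upTo m) [ m ])) ⟨∼⟩
      ++-congˡ (concatMap H (upTo m)) (++-congʳ [] (tail m (≤′⇒≤ n≤′m))) ⟨∼⟩
      ≡⇒∼ (++-identityʳ _) ⟨∼⟩ concatMap-upTo-extend H tail n≤′m

    concatMap-upTo-truncate : ∀ (H : ℕ → FS G) N n →
      (∀ k → N ≤ suc k → H k ∼ []) → (∀ k → n ≤ k → H k ∼ []) →
      concatMap H (upTo (N ∸ 1)) ∼ concatMap H (upTo n)
    concatMap-upTo-truncate H N n pastN pastn with ≤-total (N ∸ 1) n
    ... | inj₁ N∸1≤n = ∼-sym (concatMap-upTo-extend H pastN∸1 (≤⇒≤′ N∸1≤n))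
      where
      pastN∸1 : ∀ k → N ∸ 1 ≤ k → H k ∼ []
      pastN∸1 k h = pastN k (≤-trans (m≤n+m∸n N 1) (s≤s h))
    ... | inj₂ n≤N∸1 = concatMap-upTo-extend H pastn (≤⇒≤′ n≤N∸1)

    module _ {r : ℕ} where
      zipConcat : MWord r → MWord r → MWord r
      zipConcat = zipWith _++_

      bind-mulT : ∀ (F : MWord r → FS G) X Y →
                  bind F (mulT X Y) ∼ bind (λ u → bind (λ u′ → F (zipConcat u u′)) Y) X
      bind-mulT F [] Y = ∼-refl
      bind-mulT F ((a , u) ∷ X) Y =
        ≡⇒∼ (bind-++ F (map _ Y) (mulT X Y)) ⟨∼⟩ ∼-++ (row Y) (bind-mulT F X Y)
        where
        row : ∀ Y → bind F (map (λ { (b , v) → (a * b , zipConcat u v) }) Y)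
                    ∼ scale a (bind (λ u′ → F (zipConcat u u′)) Y)
        row [] = ∼-refl
        row ((b , v) ∷ Y) =
          ∼-++ (∼-sym (scale-assoc a b (F (zipConcat u v)))) (row Y) ⟨∼⟩
          ≡⇒∼ (sym (map-++ _ (scale b (F (zipConcat u v))) _))

      bind-mulT-unitʳ : ∀ (F : MWord r → FS G) X → bind F (mulT X unitT) ∼ bind F X
      bind-mulT-unitʳ F [] = ∼-refl
      bind-mulT-unitʳ F ((a , u) ∷ X) =
        ∼-++ (scale-congˡ (*-identityʳ a) (F _) ⟨∼⟩ ≡⇒∼ (cong (λ t → scale a (F t)) (zipConcat-unitʳ u)))
             (bind-mulT-unitʳ F X)
        where
        zipConcat-unitʳ : ∀ {n} (u : MWord n) → zipWith _++_ u (replicate n []) ≡ u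
        zipConcat-unitʳ [] = refl
        zipConcat-unitʳ (p ∷ u) = cong₂ _∷_ (++-identityʳ p) (zipConcat-unitʳ u)

  module LinearMaps {g₁ e₁ g₂ e₂}
           (G₁ : Set g₁) (_≋₁_ : G₁ → G₁ → Set e₁) (Slot₁ : G₁ → Set)
           (put₁ : (w : G₁) → Slot₁ w → Carrierᴹ → G₁)
           (G₂ : Set g₂) (_≋₂_ : G₂ → G₂ → Set e₂) (Slot₂ : G₂ → Set)
           (put₂ : (w : G₂) → Slot₂ w → Carrierᴹ → G₂) where
    private module Source = Quotient G₁ _≋₁_ Slot₁ put₁
    open FormalSums G₂ _≋₂_ Slot₂ put₂

    WellDefined : (G₁ → FS G₂) → Set _
    WellDefined f = ∀ {x y} → x Source.∼ y → bind f x ∼ bind f y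

    zero-wellDefined : WellDefined (λ _ → [])
    zero-wellDefined {x} {y} _ = bind-vanish (λ _ → ∼-refl) x ⟨∼⟩ ∼-sym (bind-vanish (λ _ → ∼-refl) y)

    bind-cong : (f : G₁ → FS G₂) →
      (∀ {w w′} → w ≋₁ w′ → f w ∼ f w′) →
      (∀ w s x y → f (put₁ w s (x +ᴹ y)) ∼ (f (put₁ w s x) ++ f (put₁ w s y))) →
      (∀ w s b x → f (put₁ w s (b *ₗ x)) ∼ scale b (f (put₁ w s x))) →
      WellDefined f
    bind-cong f f-gen f-add f-hom = go
      where
      go : WellDefined f
      go Source.∼-refl = ∼-refl
      go (Source.∼-sym p) = ∼-sym (go p)
      go (Source.∼-trans p q) = go p ⟨∼⟩ go q
      go (Source.∼-++ {x} {x′} {y} {y′} p q) =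
        ≡⇒∼ (bind-++ f x y) ⟨∼⟩ ∼-++ (go p) (go q) ⟨∼⟩ ≡⇒∼ (sym (bind-++ f x′ y′))
      go (Source.∼-comm x y) =
        ≡⇒∼ (bind-++ f x y) ⟨∼⟩ ∼-comm (bind f x) (bind f y) ⟨∼⟩ ≡⇒∼ (sym (bind-++ f y x))
      go (Source.∼-zero w) = ++-congʳ [] (scale-zero (f w))
      go (Source.∼-merge a b w) =
        ++-congˡ (scale a (f w)) (≡⇒∼ (++-identityʳ _)) ⟨∼⟩ scale-distribʳ a b (f w) ⟨∼⟩
        ≡⇒∼ (sym (++-identityʳ _))
      go (Source.∼-coef w p) = ++-congʳ [] (scale-congˡ p (f w))
      go (Source.∼-gen a p) = ++-congʳ [] (scale-congʳ a (f-gen p))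
      go (Source.∼-add a w s x y) =
        ++-congʳ [] (scale-congʳ a (f-add w s x y) ⟨∼⟩ ≡⇒∼ (map-++ _ (f (put₁ w s x)) _)) ⟨∼⟩
        ≡⇒∼ (++-assoc (scale a (f (put₁ w s x))) _ [])
      go (Source.∼-hom a w s b x) = ++-congʳ [] (scale-congʳ a (f-hom w s b x) ⟨∼⟩ scale-assoc a b _)

    relabel-cong : (φ : G₁ → G₂) (σ : ∀ w → Slot₁ w → Slot₂ (φ w)) →
      (∀ {w w′} → w ≋₁ w′ → φ w ≋₂ φ w′) →
      (∀ w s z → φ (put₁ w s z) ≡ put₂ (φ w) (σ w s) z) →
      WellDefined (relabel φ)
    relabel-cong φ σ φ-gen φ-put = bind-cong _ (λ p → ∼-gen 1# (φ-gen p)) φ-add φ-hom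
      where
      φ-add : ∀ w s x y → relabel φ (put₁ w s (x +ᴹ y)) ∼ (relabel φ (put₁ w s x) ++ relabel φ (put₁ w s y))
      φ-add w s x y rewrite φ-put w s (x +ᴹ y) | φ-put w s x | φ-put w s y = ∼-add 1# (φ w) (σ w s) x y
      φ-hom : ∀ w s b x → relabel φ (put₁ w s (b *ₗ x)) ∼ scale b (relabel φ (put₁ w s x))
      φ-hom w s b x rewrite φ-put w s (b *ₗ x) | φ-put w s x = ∼-hom-1# (φ w) (σ w s) b x

  -- The projection T⟨V⟩^{⊗r} → V^{⊗r} onto the tensors all of whose factors have degree one.
  singletons : ∀ {r} → MWord r → Maybe (Word r)
  singletons [] = just []
  singletons ([] ∷ w) = nothing
  singletons ((x ∷ []) ∷ w) = Maybe.map (x ∷_) (singletons w)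
  singletons ((x ∷ y ∷ l) ∷ w) = nothing

  maybeTerm : ∀ {r} → Maybe (Word r) → FS (Word r)
  maybeTerm = maybe′ (λ v → (1# , v) ∷ []) []

  project : ∀ {r} → MWord r → FS (Word r)
  project w = maybeTerm (singletons w)

  singletons-∷ : ∀ {r} p (w : MWord r) → singletons w ≡ nothing → singletons (p ∷ w) ≡ nothing
  singletons-∷ [] w eq = refl
  singletons-∷ (x ∷ []) w eq = cong (Maybe.map (x ∷_)) eq
  singletons-∷ (x ∷ y ∷ l) w eq = refl

  singletons-update : ∀ {r} (w : MWord r) i j z →
                      singletons (mput w (i , j) z) ≡ Maybe.map (Vec._[ i ]≔ z) (singletons w)
  singletons-update ((x ∷ []) ∷ w) zero zero z = map-∘ (singletons w)
  singletons-update ((x ∷ y ∷ l) ∷ w) zero zero z = refl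
  singletons-update ((x ∷ y ∷ l) ∷ w) zero (suc zero) z = refl
  singletons-update ((x ∷ y ∷ l) ∷ w) zero (suc (suc j)) z = refl
  singletons-update ([] ∷ w) (suc i) j z = refl
  singletons-update ((x ∷ []) ∷ w) (suc i) j z =
    trans (cong (Maybe.map (x ∷_)) (singletons-update w i j z))
          (trans (sym (map-∘ (singletons w))) (map-∘ (singletons w)))
  singletons-update ((x ∷ y ∷ l) ∷ w) (suc i) j z = refl

  singletons-cong : ∀ {r} {w w′ : MWord r} → VecPW.Pointwise (ListPW.Pointwise _≈ᴹ_) w w′ →
                    MaybePW.Pointwise (VecPW.Pointwise _≈ᴹ_) (singletons w) (singletons w′)
  singletons-cong [] = just []
  singletons-cong ([] ∷ ps) = nothing
  singletons-cong ((p ∷ []) ∷ ps) = cons-cong p (singletons-cong ps)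
    where
    cons-cong : ∀ {n x x′} {mv mv′ : Maybe (Word n)} → x ≈ᴹ x′ →
                MaybePW.Pointwise (VecPW.Pointwise _≈ᴹ_) mv mv′ →
                MaybePW.Pointwise (VecPW.Pointwise _≈ᴹ_) (Maybe.map (x ∷_) mv) (Maybe.map (x′ ∷_) mv′)
    cons-cong p nothing = nothing
    cons-cong p (just q) = just (p ∷ q)
  singletons-cong ((p ∷ q ∷ ps′) ∷ ps) = nothing

  module _ {r : ℕ} where
    open FormalSums (Word r) (VecPW.Pointwise _≈ᴹ_) (λ _ → Fin r) Vec._[_]≔_
    open LinearMaps (MWord r) (VecPW.Pointwise (ListPW.Pointwise _≈ᴹ_)) MSlot mput
                    (Word r) (VecPW.Pointwise _≈ᴹ_) (λ _ → Fin r) Vec._[_]≔_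

    project-wellDefined : WellDefined project
    project-wellDefined = bind-cong project project-gen project-add project-hom
      where
      maybeTerm-cong : ∀ {mv mv′} → MaybePW.Pointwise (VecPW.Pointwise _≈ᴹ_) mv mv′ →
                       maybeTerm mv ∼ maybeTerm mv′
      maybeTerm-cong nothing = ∼-refl
      maybeTerm-cong (just p) = ∼-gen 1# p

      project-gen : ∀ {w w′} → VecPW.Pointwise (ListPW.Pointwise _≈ᴹ_) w w′ → project w ∼ project w′
      project-gen p = maybeTerm-cong (singletons-cong p)

      maybeTerm-add : ∀ mv i x y →
        maybeTerm (Maybe.map (Vec._[ i ]≔ (x +ᴹ y)) mv)
          ∼ (maybeTerm (Maybe.map (Vec._[ i ]≔ x) mv) ++ maybeTerm (Maybe.map (Vec._[ i ]≔ y) mv))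
      maybeTerm-add nothing i x y = ∼-refl
      maybeTerm-add (just v) i x y = ∼-add 1# v i x y

      maybeTerm-hom : ∀ mv i b x →
        maybeTerm (Maybe.map (Vec._[ i ]≔ (b *ₗ x)) mv) ∼ scale b (maybeTerm (Maybe.map (Vec._[ i ]≔ x) mv))
      maybeTerm-hom nothing i b x = ∼-refl
      maybeTerm-hom (just v) i b x = ∼-hom-1# v i b x

      project-add : ∀ w s x y → project (mput w s (x +ᴹ y)) ∼ (project (mput w s x) ++ project (mput w s y))
      project-add w (i , j) x y
        rewrite singletons-update w i j (x +ᴹ y) | singletons-update w i j x | singletons-update w i j y =
        maybeTerm-add (singletons w) i x y

      project-hom : ∀ w s b x → project (mput w s (b *ₗ x)) ∼ scale b (project (mput w s x))
      project-hom w (i , j) b x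
        rewrite singletons-update w i j (b *ₗ x) | singletons-update w i j x =
        maybeTerm-hom (singletons w) i b x

  open FormalSums (Word 3) (VecPW.Pointwise _≈ᴹ_) (λ _ → Fin 3) Vec._[_]≔_
  module Lin₂₃ = LinearMaps (Word 2) (VecPW.Pointwise _≈ᴹ_) (λ _ → Fin 2) Vec._[_]≔_
                            (Word 3) (VecPW.Pointwise _≈ᴹ_) (λ _ → Fin 3) Vec._[_]≔_
  module Lin₃₃ = LinearMaps (Word 3) (VecPW.Pointwise _≈ᴹ_) (λ _ → Fin 3) Vec._[_]≔_
                            (Word 3) (VecPW.Pointwise _≈ᴹ_) (λ _ → Fin 3) Vec._[_]≔_

  padʳ : Carrierᴹ → Word 2 → Word 3
  padʳ b (x ∷ y ∷ []) = x ∷ y ∷ b ∷ []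

  padˡ : Carrierᴹ → Word 2 → Word 3
  padˡ a (x ∷ y ∷ []) = a ∷ x ∷ y ∷ []

  padʳ-wellDefined : ∀ b → Lin₂₃.WellDefined (relabel (padʳ b))
  padʳ-wellDefined b = Lin₂₃.relabel-cong (padʳ b) slot gen put
    where
    slot : Word 2 → Fin 2 → Fin 3
    slot _ zero = zero
    slot _ (suc zero) = suc zero
    gen : ∀ {w w′} → VecPW.Pointwise _≈ᴹ_ w w′ → VecPW.Pointwise _≈ᴹ_ (padʳ b w) (padʳ b w′)
    gen (p ∷ q ∷ []) = p ∷ q ∷ ≈ᴹ-refl ∷ []
    put : ∀ w s z → padʳ b (w Vec.[ s ]≔ z) ≡ padʳ b w Vec.[ slot w s ]≔ z
    put (x ∷ y ∷ []) zero z = refl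
    put (x ∷ y ∷ []) (suc zero) z = refl

  padˡ-wellDefined : ∀ a → Lin₂₃.WellDefined (relabel (padˡ a))
  padˡ-wellDefined a = Lin₂₃.relabel-cong (padˡ a) slot gen put
    where
    slot : Word 2 → Fin 2 → Fin 3
    slot _ zero = suc zero
    slot _ (suc zero) = suc (suc zero)
    gen : ∀ {w w′} → VecPW.Pointwise _≈ᴹ_ w w′ → VecPW.Pointwise _≈ᴹ_ (padˡ a w) (padˡ a w′)
    gen (p ∷ q ∷ []) = ≈ᴹ-refl ∷ p ∷ q ∷ []
    put : ∀ w s z → padˡ a (w Vec.[ s ]≔ z) ≡ padˡ a w Vec.[ slot w s ]≔ z
    put (x ∷ y ∷ []) zero z = refl
    put (x ∷ y ∷ []) (suc zero) z = refl

  padʳ-cong : ∀ {b b′} → b ≈ᴹ b′ → ∀ w → relabel (padʳ b) w ∼ relabel (padʳ b′) w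
  padʳ-cong p (x ∷ y ∷ []) = ∼-gen 1# (≈ᴹ-refl ∷ ≈ᴹ-refl ∷ p ∷ [])

  padʳ-+ : ∀ b b′ w → relabel (padʳ (b +ᴹ b′)) w ∼ (relabel (padʳ b) w ++ relabel (padʳ b′) w)
  padʳ-+ b b′ (x ∷ y ∷ []) = ∼-add 1# (x ∷ y ∷ b ∷ []) (suc (suc zero)) b b′

  padʳ-* : ∀ a b w → relabel (padʳ (a *ₗ b)) w ∼ scale a (relabel (padʳ b) w)
  padʳ-* a b (x ∷ y ∷ []) = ∼-hom-1# (x ∷ y ∷ b ∷ []) (suc (suc zero)) a b

  padˡ-cong : ∀ {a a′} → a ≈ᴹ a′ → ∀ w → relabel (padˡ a) w ∼ relabel (padˡ a′) w
  padˡ-cong p (x ∷ y ∷ []) = ∼-gen 1# (p ∷ ≈ᴹ-refl ∷ ≈ᴹ-refl ∷ [])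

  padˡ-+ : ∀ a a′ w → relabel (padˡ (a +ᴹ a′)) w ∼ (relabel (padˡ a) w ++ relabel (padˡ a′) w)
  padˡ-+ a a′ (x ∷ y ∷ []) = ∼-add 1# (a ∷ x ∷ y ∷ []) zero a a′

  padˡ-* : ∀ b a w → relabel (padˡ (b *ₗ a)) w ∼ scale b (relabel (padˡ a) w)
  padˡ-* b a (x ∷ y ∷ []) = ∼-hom-1# (a ∷ x ∷ y ∷ []) zero b a

  total : MWord 2 → ℕ
  total (p ∷ q ∷ []) = length p ℕ.+ length q

  total-zipConcat : ∀ u u′ → total (zipConcat u u′) ≡ total u ℕ.+ total u′
  total-zipConcat (p ∷ q ∷ []) (p′ ∷ q′ ∷ []) =
    trans (cong₂ ℕ._+_ (length-++ p) (length-++ q))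
          (+-interchange (length p) (length p′) (length q) (length q′))

  project-snoc : List Carrierᴹ → MWord 2 → FS (Word 3)
  project-snoc q (p₀ ∷ p₁ ∷ []) = project (p₀ ∷ p₁ ∷ q ∷ [])

  project-cons : List Carrierᴹ → MWord 2 → FS (Word 3)
  project-cons p (p₁ ∷ p₂ ∷ []) = project (p ∷ p₁ ∷ p₂ ∷ [])

  project-snoc-vanish : ∀ q → singletons (q ∷ []) ≡ nothing → ∀ u → project-snoc q u ∼ []
  project-snoc-vanish q eq (p₀ ∷ p₁ ∷ []) = ≡⇒∼ (cong maybeTerm (singletons-∷ p₀ _ (singletons-∷ p₁ _ eq)))

  project-cons-vanish : ∀ a u → 3 ≤ total u → project-cons (a ∷ []) u ∼ []
  project-cons-vanish a ([] ∷ q ∷ []) h = ∼-refl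
  project-cons-vanish a ((x ∷ y ∷ l) ∷ q ∷ []) h = ∼-refl
  project-cons-vanish a ((x ∷ []) ∷ [] ∷ []) h = ∼-refl
  project-cons-vanish a ((x ∷ []) ∷ (y ∷ z ∷ l) ∷ []) h = ∼-refl
  project-cons-vanish a ((x ∷ []) ∷ (y ∷ []) ∷ []) (s≤s (s≤s ()))

  module PreLie (B : LocallyFiniteBraceCoalgebra) where
    open LocallyFiniteBraceCoalgebra B

    -- δ₁⊗Id and Id⊗δ₁ of Defs, restated through relabel so that their well-definedness reduces to padʳ, padˡ.
    δ⊗id : Word 2 → FS (Word 3)
    δ⊗id (a ∷ b ∷ []) = bind (relabel (padʳ b)) (δ 0 a)

    id⊗δ : Word 2 → FS (Word 3)
    id⊗δ (a ∷ b ∷ []) = bind (relabel (padˡ a)) (δ 0 b)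

    δ⊗id-wellDefined : Lin₂₃.WellDefined δ⊗id
    δ⊗id-wellDefined = Lin₂₃.bind-cong δ⊗id gen add hom
      where
      gen : ∀ {w w′} → VecPW.Pointwise _≈ᴹ_ w w′ → δ⊗id w ∼ δ⊗id w′
      gen {a ∷ b ∷ []} {a′ ∷ b′ ∷ []} (p ∷ q ∷ []) =
        padʳ-wellDefined b (δ-cong 0 p) ⟨∼⟩ bind-congˡ (padʳ-cong q) (δ 0 a′)
      add : ∀ w s x y → δ⊗id (w Vec.[ s ]≔ (x +ᴹ y)) ∼ (δ⊗id (w Vec.[ s ]≔ x) ++ δ⊗id (w Vec.[ s ]≔ y))
      add (a ∷ b ∷ []) zero x y =
        padʳ-wellDefined b (δ-+ 0 x y) ⟨∼⟩ ≡⇒∼ (bind-++ (relabel (padʳ b)) (δ 0 x) (δ 0 y))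
      add (a ∷ b ∷ []) (suc zero) x y =
        bind-congˡ (padʳ-+ x y) (δ 0 a) ⟨∼⟩
        bind-++ᶠ (relabel (padʳ x)) (relabel (padʳ y)) (δ 0 a)
      hom : ∀ w s b x → δ⊗id (w Vec.[ s ]≔ (b *ₗ x)) ∼ scale b (δ⊗id (w Vec.[ s ]≔ x))
      hom (a ∷ c ∷ []) zero b x =
        padʳ-wellDefined c (δ-* 0 b x) ⟨∼⟩ bind-scale (relabel (padʳ c)) b (δ 0 x)
      hom (a ∷ c ∷ []) (suc zero) b x =
        bind-congˡ (padʳ-* b x) (δ 0 a) ⟨∼⟩
        bind-scaleᶠ (relabel (padʳ x)) b (δ 0 a)

    id⊗δ-wellDefined : Lin₂₃.WellDefined id⊗δ
    id⊗δ-wellDefined = Lin₂₃.bind-cong id⊗δ gen add hom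
      where
      gen : ∀ {w w′} → VecPW.Pointwise _≈ᴹ_ w w′ → id⊗δ w ∼ id⊗δ w′
      gen {a ∷ b ∷ []} {a′ ∷ b′ ∷ []} (p ∷ q ∷ []) =
        padˡ-wellDefined a (δ-cong 0 q) ⟨∼⟩ bind-congˡ (padˡ-cong p) (δ 0 b′)
      add : ∀ w s x y → id⊗δ (w Vec.[ s ]≔ (x +ᴹ y)) ∼ (id⊗δ (w Vec.[ s ]≔ x) ++ id⊗δ (w Vec.[ s ]≔ y))
      add (a ∷ b ∷ []) zero x y =
        bind-congˡ (padˡ-+ x y) (δ 0 b) ⟨∼⟩
        bind-++ᶠ (relabel (padˡ x)) (relabel (padˡ y)) (δ 0 b)
      add (a ∷ b ∷ []) (suc zero) x y =
        padˡ-wellDefined a (δ-+ 0 x y) ⟨∼⟩ ≡⇒∼ (bind-++ (relabel (padˡ a)) (δ 0 x) (δ 0 y))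
      hom : ∀ w s b x → id⊗δ (w Vec.[ s ]≔ (b *ₗ x)) ∼ scale b (id⊗δ (w Vec.[ s ]≔ x))
      hom (a ∷ c ∷ []) zero b x =
        bind-congˡ (padˡ-* b x) (δ 0 c) ⟨∼⟩
        bind-scaleᶠ (relabel (padˡ x)) b (δ 0 c)
      hom (a ∷ c ∷ []) (suc zero) b x = padˡ-wellDefined a (δ-* 0 b x) ⟨∼⟩ bind-scale (relabel (padˡ a)) b (δ 0 x)

    τ : Word 3 → Word 3
    τ = Id⊗τ (δ 0)

    τ-wellDefined : Lin₃₃.WellDefined (relabel τ)
    τ-wellDefined = Lin₃₃.relabel-cong τ slot gen put
      where
      slot : Word 3 → Fin 3 → Fin 3
      slot _ zero = zero
      slot _ (suc zero) = suc (suc zero)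
      slot _ (suc (suc zero)) = suc zero
      gen : ∀ {w w′} → VecPW.Pointwise _≈ᴹ_ w w′ → VecPW.Pointwise _≈ᴹ_ (τ w) (τ w′)
      gen (p ∷ q ∷ r ∷ []) = p ∷ r ∷ q ∷ []
      put : ∀ w s z → τ (w Vec.[ s ]≔ z) ≡ τ w Vec.[ slot w s ]≔ z
      put (x ∷ y ∷ d ∷ []) zero z = refl
      put (x ∷ y ∷ d ∷ []) (suc zero) z = refl
      put (x ∷ y ∷ d ∷ []) (suc (suc zero)) z = refl

    symmetrize : Word 3 → FS (Word 3)
    symmetrize w = relabel τ w ++ relabel (λ w → w) w

    symmetrize-wellDefined : Lin₃₃.WellDefined symmetrize
    symmetrize-wellDefined {x} {y} p =
      bind-++ᶠ (relabel τ) (relabel (λ w → w)) x ⟨∼⟩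
      ∼-++ (τ-wellDefined p) (bind-relabel-id x ⟨∼⟩ p ⟨∼⟩ ∼-sym (bind-relabel-id y)) ⟨∼⟩
      ∼-sym (bind-++ᶠ (relabel τ) (relabel (λ w → w)) y)

    τ-symmetrize : ∀ X → bind (relabel τ) (bind symmetrize X) ∼ bind symmetrize X
    τ-symmetrize X = bind-bind symmetrize (relabel τ) X ⟨∼⟩ bind-congˡ swap X
      where
      swap : ∀ w → bind (relabel τ) (symmetrize w) ∼ symmetrize w
      swap (a ∷ b ∷ d ∷ []) =
        ∼-++ {x = (1# * 1# , a ∷ b ∷ d ∷ []) ∷ []} (∼-coef _ (*-identityʳ 1#))
             (∼-++ {x = (1# * 1# , a ∷ d ∷ b ∷ []) ∷ []} (∼-coef _ (*-identityʳ 1#)) ∼-refl) ⟨∼⟩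
        ∼-comm ((1# , a ∷ b ∷ d ∷ []) ∷ []) ((1# , a ∷ d ∷ b ∷ []) ∷ [])

    𝟙⊗_ : Carrierᴹ → MWord 2
    𝟙⊗ b = [] ∷ (b ∷ []) ∷ []

    _⊗𝟙 : Carrierᴹ → MWord 2
    b ⊗𝟙 = (b ∷ []) ∷ [] ∷ []

    δSum : (∀ {k} → Word (suc (suc k)) → FS (Word 3)) → Carrierᴹ → FS (Word 3)
    δSum Φ b = concatMap (λ k → bind Φ (δ k b)) (upTo (N b ∸ 1))

    δSum-vanish : ∀ {Φ : ∀ {k} → Word (suc (suc k)) → FS (Word 3)} b →
                          (∀ {k} (w : Word (suc (suc k))) → Φ w ∼ []) → δSum Φ b ∼ []
    δSum-vanish b Φ-vanish = concatMap-vanish (λ k → bind-vanish Φ-vanish (δ k b)) (upTo (N b ∸ 1))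

    bind-Δv : ∀ (F : MWord 2 → FS (Word 3)) b →
              bind F (Δv b) ∼ (F (𝟙⊗ b) ++ (F (b ⊗𝟙) ++ δSum (λ w → F (embed w)) b))
    bind-Δv F b = ∼-++ (scale-identity (F (𝟙⊗ b))) (∼-++ (scale-identity (F (b ⊗𝟙))) δ-terms)
      where
      δ-terms : bind F (concatMap (λ k → bind (relabel embed) (δ k b)) (upTo (N b ∸ 1)))
                ∼ δSum (λ w → F (embed w)) b
      δ-terms = ≡⇒∼ (bind-concatMap F _ (upTo (N b ∸ 1))) ⟨∼⟩
        concatMap-cong (λ k → bind-bind (relabel embed) F (δ k b) ⟨∼⟩
                              bind-congˡ (λ w → bind-return F (embed w)) (δ k b)) (upTo (N b ∸ 1))

    -- Local finiteness enters only here: δ₁ v or δ₂ v may be missing from the sum Δv v, but then it vanishes.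
    bind-Δv-≤3 : ∀ (F : MWord 2 → FS (Word 3)) b (Φ : Word 2 → FS (Word 3)) (Ψ : Word 3 → FS (Word 3)) →
      (∀ w → F (embed w) ∼ Φ w) → (∀ w → F (embed w) ∼ Ψ w) →
      Lin₂₃.WellDefined Φ → Lin₃₃.WellDefined Ψ →
      (∀ {k} (w : Word (4 ℕ.+ k)) → F (embed w) ∼ []) →
      bind F (Δv b) ∼ (F (𝟙⊗ b) ++ (F (b ⊗𝟙) ++ (bind Φ (δ 0 b) ++ bind Ψ (δ 1 b))))
    bind-Δv-≤3 F b Φ Ψ F∼Φ F∼Ψ Φ-wd Ψ-wd F-high =
      bind-Δv F b ⟨∼⟩
      ++-congˡ (F (𝟙⊗ b)) (++-congˡ (F (b ⊗𝟙)) (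
        concatMap-upTo-truncate H (N b) 2 pastN past2 ⟨∼⟩
        ∼-++ (bind-congˡ F∼Φ (δ 0 b)) (≡⇒∼ (++-identityʳ _) ⟨∼⟩ bind-congˡ F∼Ψ (δ 1 b))))
      where
      H : ℕ → FS (Word 3)
      H k = bind (λ w → F (embed w)) (δ k b)
      pastN : ∀ k → N b ≤ suc k → H k ∼ []
      pastN zero h = bind-congˡ F∼Φ (δ 0 b) ⟨∼⟩ Φ-wd (proj₂ (locallyFinite b) 0 h)
      pastN (suc zero) h = bind-congˡ F∼Ψ (δ 1 b) ⟨∼⟩ Ψ-wd (proj₂ (locallyFinite b) 1 h)
      pastN (suc (suc k)) h = bind-vanish F-high (δ (suc (suc k)) b)
      past2 : ∀ k → 2 ≤ k → H k ∼ []
      past2 (suc (suc k)) _ = bind-vanish F-high (δ (suc (suc k)) b)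
      past2 (suc zero) (s≤s ())

    bind-Δv-≤2 : ∀ (F : MWord 2 → FS (Word 3)) b (Φ : Word 2 → FS (Word 3)) →
      (∀ w → F (embed w) ∼ Φ w) → Lin₂₃.WellDefined Φ →
      (∀ {k} (w : Word (3 ℕ.+ k)) → F (embed w) ∼ []) →
      bind F (Δv b) ∼ (F (𝟙⊗ b) ++ (F (b ⊗𝟙) ++ bind Φ (δ 0 b)))
    bind-Δv-≤2 F b Φ F∼Φ Φ-wd F-high =
      bind-Δv-≤3 F b Φ (λ _ → []) F∼Φ F-high Φ-wd Lin₃₃.zero-wellDefined F-high ⟨∼⟩
      ++-congˡ (F (𝟙⊗ b)) (++-congˡ (F (b ⊗𝟙))
        (++-congˡ (bind Φ (δ 0 b)) (bind-vanish (λ _ → ∼-refl) (δ 1 b)) ⟨∼⟩ ≡⇒∼ (++-identityʳ _)))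

    bind-Δv-vanish : ∀ (F : MWord 2 → FS (Word 3)) b → (∀ u → 1 ≤ total u → F u ∼ []) → bind F (Δv b) ∼ []
    bind-Δv-vanish F b F-vanish =
      bind-Δv F b ⟨∼⟩
      ∼-++ (F-vanish _ (s≤s z≤n))
           (∼-++ (F-vanish _ (s≤s z≤n))
                 (δSum-vanish b (λ { (x ∷ ys) → F-vanish (embed (x ∷ ys)) (s≤s z≤n) })))

    -- Every term of Δ(b₁ ⋯ bₙ) has total degree at least n.
    bind-Δword-vanish : ∀ l (F : MWord 2 → FS (Word 3)) → (∀ u → length l ≤ total u → F u ∼ []) →
                        bind F (Δword l) ∼ []
    bind-Δword-vanish [] F F-vanish = ∼-++ (scale-congʳ 1# (F-vanish _ z≤n)) ∼-refl
    bind-Δword-vanish (b ∷ l) F F-vanish =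
      bind-mulT F (Δv b) (Δword l) ⟨∼⟩
      bind-Δv-vanish _ b (λ u 1≤u → bind-Δword-vanish l _ (λ u′ l≤u′ →
        F-vanish (zipConcat u u′)
                 (subst (suc (length l) ≤_) (sym (total-zipConcat u u′)) (+-mono-≤ 1≤u l≤u′))))

    bind-Δword-single : ∀ (F : MWord 2 → FS (Word 3)) b → (∀ u → 2 ≤ total u → F u ∼ []) →
                        bind F (Δword (b ∷ [])) ∼ (F (𝟙⊗ b) ++ F (b ⊗𝟙))
    bind-Δword-single F b F-vanish =
      bind-mulT-unitʳ F (Δv b) ⟨∼⟩ bind-Δv F b ⟨∼⟩
      ++-congˡ (F (𝟙⊗ b))
        (++-congˡ (F (b ⊗𝟙))
           (δSum-vanish b (λ { (x ∷ y ∷ ys) → F-vanish (embed (x ∷ y ∷ ys)) (s≤s (s≤s z≤n)) })) ⟨∼⟩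
         ≡⇒∼ (++-identityʳ _))

    projΔ⊗id : MWord 2 → FS (Word 3)
    projΔ⊗id (u ∷ q ∷ []) = bind (project-snoc q) (Δword u)

    projId⊗Δ : MWord 2 → FS (Word 3)
    projId⊗Δ (u ∷ w ∷ []) = bind (project-cons u) (Δword w)

    project-Δ⊗id : ∀ y → bind project (Δ⊗id y) ∼ bind projΔ⊗id y
    project-Δ⊗id y = bind-bind _ project y ⟨∼⟩
      bind-congˡ (λ { (u ∷ q ∷ []) → bind-bind _ project (Δword u) ⟨∼⟩
        bind-congˡ (λ { (a ∷ b ∷ []) → bind-return project (a ∷ b ∷ q ∷ []) }) (Δword u) }) y

    project-id⊗Δ : ∀ y → bind project (id⊗Δ y) ∼ bind projId⊗Δ y
    project-id⊗Δ y = bind-bind _ project y ⟨∼⟩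
      bind-congˡ (λ { (u ∷ w ∷ []) → bind-bind _ project (Δword w) ⟨∼⟩
        bind-congˡ (λ { (a ∷ b ∷ []) → bind-return project (u ∷ a ∷ b ∷ []) }) (Δword w) }) y

    bind-Δ-generator : ∀ (F : MWord 2 → FS (Word 3)) v →
                       bind F (Δ ((1# , (v ∷ []) ∷ []) ∷ [])) ∼ bind F (Δword (v ∷ []))
    bind-Δ-generator F v =
      ≡⇒∼ (trans (bind-++ F (scale 1# (Δword (v ∷ []))) []) (++-identityʳ _)) ⟨∼⟩
      bind-scale F 1# (Δword (v ∷ [])) ⟨∼⟩ scale-identity _

    projΔ⊗id-embed₂ : ∀ w → projΔ⊗id (embed w) ∼ δ⊗id w
    projΔ⊗id-embed₂ (a ∷ b ∷ []) =
      bind-mulT-unitʳ (project-snoc (b ∷ [])) (Δv a) ⟨∼⟩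
      bind-Δv-≤2 (project-snoc (b ∷ [])) a (relabel (padʳ b)) (λ { (x ∷ y ∷ []) → ∼-refl })
                 (padʳ-wellDefined b) (λ { (x ∷ y ∷ z ∷ ys) → ∼-refl })

    projΔ⊗id-embed≥3 : ∀ {k} (w : Word (3 ℕ.+ k)) → projΔ⊗id (embed w) ∼ []
    projΔ⊗id-embed≥3 (a ∷ b ∷ c ∷ bs) =
      bind-vanish (project-snoc-vanish (b ∷ c ∷ Vec.toList bs) refl) (Δword (a ∷ []))

    projΔ⊗id-Δ : ∀ v → bind projΔ⊗id (Δword (v ∷ [])) ∼ bind δ⊗id (δ 0 v)
    projΔ⊗id-Δ v =
      bind-mulT-unitʳ projΔ⊗id (Δv v) ⟨∼⟩
      bind-Δv-≤2 projΔ⊗id v δ⊗id projΔ⊗id-embed₂ δ⊗id-wellDefined projΔ⊗id-embed≥3 ⟨∼⟩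
      ++-congʳ (bind δ⊗id (δ 0 v)) (bind-vanish (project-snoc-vanish [] refl) (Δword (v ∷ [])))

    projId⊗Δ-embed₂ : ∀ w → projId⊗Δ (embed w) ∼ id⊗δ w
    projId⊗Δ-embed₂ (a ∷ b ∷ []) =
      bind-mulT-unitʳ (project-cons (a ∷ [])) (Δv b) ⟨∼⟩
      bind-Δv-≤2 (project-cons (a ∷ [])) b (relabel (padˡ a)) (λ { (x ∷ y ∷ []) → ∼-refl })
                 (padˡ-wellDefined a) (λ { (x ∷ y ∷ z ∷ ys) → ∼-refl })

    -- Of the products (1 ⊗ b₁ + b₁ ⊗ 1)(1 ⊗ b₂ + b₂ ⊗ 1), only b₂ ⊗ b₁ and b₁ ⊗ b₂ survive the projection;
    -- all other terms of Δ(b₁ b₂) have total degree at least 3.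
    projId⊗Δ-embed₃ : ∀ w → projId⊗Δ (embed w) ∼ symmetrize w
    projId⊗Δ-embed₃ (a ∷ b₁ ∷ b₂ ∷ []) =
      bind-mulT (project-cons (a ∷ [])) (Δv b₁) (Δword (b₂ ∷ [])) ⟨∼⟩ bind-Δv F b₁ ⟨∼⟩
      ∼-++ (bind-Δword-single (G (𝟙⊗ b₁)) b₂ (λ u′ h → G-vanish (𝟙⊗ b₁) u′ (s≤s h)))
           (∼-++ (bind-Δword-single (G (b₁ ⊗𝟙)) b₂ (λ u′ h → G-vanish (b₁ ⊗𝟙) u′ (s≤s h)))
                 (δSum-vanish b₁ (λ { (x ∷ y ∷ ys) → F-high (embed (x ∷ y ∷ ys)) (s≤s (s≤s z≤n)) })))
      where
      G : MWord 2 → MWord 2 → FS (Word 3)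
      G u u′ = project-cons (a ∷ []) (zipConcat u u′)
      F : MWord 2 → FS (Word 3)
      F u = bind (G u) (Δword (b₂ ∷ []))
      G-vanish : ∀ u u′ → 3 ≤ total u ℕ.+ total u′ → G u u′ ∼ []
      G-vanish u u′ h = project-cons-vanish a (zipConcat u u′) (subst (3 ≤_) (sym (total-zipConcat u u′)) h)
      F-high : ∀ u → 2 ≤ total u → F u ∼ []
      F-high u h = bind-Δword-vanish (b₂ ∷ []) (G u) (λ u′ h′ → G-vanish u u′ (+-mono-≤ h h′))

    projId⊗Δ-embed≥4 : ∀ {k} (w : Word (4 ℕ.+ k)) → projId⊗Δ (embed w) ∼ []
    projId⊗Δ-embed≥4 (a ∷ b₁ ∷ b₂ ∷ b₃ ∷ bs) =
      bind-Δword-vanish (b₁ ∷ b₂ ∷ b₃ ∷ Vec.toList bs) (project-cons (a ∷ []))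
        (λ u h → project-cons-vanish a u (≤-trans (s≤s (s≤s (s≤s z≤n))) h))

    projId⊗Δ-Δ : ∀ v → bind projId⊗Δ (Δword (v ∷ [])) ∼ (bind id⊗δ (δ 0 v) ++ bind symmetrize (δ 1 v))
    projId⊗Δ-Δ v =
      bind-mulT-unitʳ projId⊗Δ (Δv v) ⟨∼⟩
      bind-Δv-≤3 projId⊗Δ v id⊗δ symmetrize projId⊗Δ-embed₂ projId⊗Δ-embed₃
                 id⊗δ-wellDefined symmetrize-wellDefined projId⊗Δ-embed≥4 ⟨∼⟩
      ++-congʳ _ (bind-vanish {f = project-cons []} (λ { (p ∷ q ∷ []) → ∼-refl }) (Δword (v ∷ [])))

    project-coassociativity : ∀ v → bind δ⊗id (δ 0 v) ∼ (bind id⊗δ (δ 0 v) ++ bind symmetrize (δ 1 v))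
    project-coassociativity v = begin
      bind δ⊗id (δ 0 v)                               ≈⟨ projΔ⊗id-Δ v ⟨
      bind projΔ⊗id (Δword (v ∷ []))                  ≈⟨ bind-Δ-generator projΔ⊗id v ⟨
      bind projΔ⊗id (Δ x₀)                            ≈⟨ project-Δ⊗id (Δ x₀) ⟨
      bind project (Δ⊗id (Δ x₀))                      ≈⟨ project-wellDefined (coassociative x₀) ⟩
      bind project (id⊗Δ (Δ x₀))                      ≈⟨ project-id⊗Δ (Δ x₀) ⟩
      bind projId⊗Δ (Δ x₀)                            ≈⟨ bind-Δ-generator projId⊗Δ v ⟩
      bind projId⊗Δ (Δword (v ∷ []))                  ≈⟨ projId⊗Δ-Δ v ⟩
      bind id⊗δ (δ 0 v) ++ bind symmetrize (δ 1 v)    ∎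
      where
      open SetoidReasoning ∼-setoid
      x₀ : FS (MWord 1)
      x₀ = (1# , (v ∷ []) ∷ []) ∷ []

    assocδ₁≈symmetrize : ∀ v → assocδ₁ (δ 0) v ∼ bind symmetrize (δ 1 v)
    assocδ₁≈symmetrize v = begin
      assocδ₁ (δ 0) v
        ≈⟨ bind-++ᶠ (δ₁⊗Id (δ 0)) (λ w → neg (Id⊗δ₁ (δ 0) w)) (δ 0 v) ⟩
      bind (δ₁⊗Id (δ 0)) (δ 0 v) ++ bind (λ w → neg (Id⊗δ₁ (δ 0) w)) (δ 0 v)
        ≈⟨ ∼-++ (≡⇒∼ (bind-≗ δ₁⊗Id-unfold (δ 0 v)))
                (bind-scaleᶠ (Id⊗δ₁ (δ 0)) (- 1#) (δ 0 v) ⟨∼⟩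
                 ≡⇒∼ (cong neg (bind-≗ Id⊗δ₁-unfold (δ 0 v)))) ⟩
      bind δ⊗id (δ 0 v) ++ neg A   ≈⟨ ++-congʳ (neg A) (project-coassociativity v) ⟩
      (A ++ S) ++ neg A            ≈⟨ ++-congʳ (neg A) (∼-comm A S) ⟩
      (S ++ A) ++ neg A            ≡⟨ ++-assoc S A (neg A) ⟩
      S ++ (A ++ neg A)            ≈⟨ ++-congˡ S (neg-inverseʳ A) ⟩
      S ++ []                      ≡⟨ ++-identityʳ S ⟩
      S                            ∎
      where
      open SetoidReasoning ∼-setoid
      A = bind id⊗δ (δ 0 v)
      S = bind symmetrize (δ 1 v)
      δ₁⊗Id-unfold : ∀ w → δ₁⊗Id (δ 0) w ≡ δ⊗id w
      δ₁⊗Id-unfold (a ∷ b ∷ []) = bind-≗ {h = relabel (padʳ b)} (λ { (x ∷ y ∷ []) → refl }) (δ 0 a)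
      Id⊗δ₁-unfold : ∀ w → Id⊗δ₁ (δ 0) w ≡ id⊗δ w
      Id⊗δ₁-unfold (a ∷ b ∷ []) = bind-≗ {h = relabel (padˡ a)} (λ { (x ∷ y ∷ []) → refl }) (δ 0 b)

    isPreLieCoalgebra : IsPreLieCoalgebra (δ 0)
    isPreLieCoalgebra v =
      assocδ₁≈symmetrize v ⟨∼⟩ ∼-sym (τ-symmetrize (δ 1 v)) ⟨∼⟩
      τ-wellDefined (∼-sym (assocδ₁≈symmetrize v))

mainTheorem12 : ∀ {c ℓ m ℓm} (K : Field c ℓ) (V : Module (Field.commutativeRing K) m ℓm)
                  (B : Tensors.LocallyFiniteBraceCoalgebra K V) →
                  Tensors.IsPreLieCoalgebra K V (Tensors.LocallyFiniteBraceCoalgebra.δ B 0)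
mainTheorem12 K V B = Proof.PreLie.isPreLieCoalgebra K V B
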